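{- Let $m\ge 2$ and $\gamma\ge 1$ be integers, let $g$ be an integer, and let $T$ be a numerical semigroup of genus $\gamma$ and multiplicity $m$, written as $T = \langle m, me_1+1, me_2+2, \ldots, me_{m-1}+(m-1)\rangle$, where for each $i\in\{1,\dots,m-1\}$, $me_i+i=\min\{t\in T: t\equiv i \pmod m\}$. Then a numerical semigroup $S$ has genus $g$, exactly $\gamma$ even gaps, and satisfies $S/2 = T$ if and only if $$S = \langle 2m,\ 2me_1+2,\ \ldots,\ 2me_{m-1}+(2m-2),\ 2mk_1+1,\ 2mk_3+3,\ \ldots,\ 2mk_{2m-1}+(2m-1) \rangle,$$ where $(k_1,k_3,\ldots,k_{2m-1}) \in \mathbb{N}_0^{m}$ is a solution $(X_1,X_3,\dots,X_{2m-1})=(k_1,k_3,\dots,k_{2m-1})$ of the system $$ \begin{cases} X_{2i-1} + e_j \geq X_{2(i+j)-1}, & \text{for } 1 \leq i \leq m,\ 1 \leq j \leq m-1,\ i + j \leq m; \\ X_{2i-1} + e_j + 1 \geq X_{2(i+j-m)-1}, & \text{for } 1 \leq i \leq m,\ 1 \leq j \leq m-1,\ i + j > m; \\ X_{2i-1} + X_{2j-1} \geq e_{i+j-1}, & \text{for } 1 \leq i \leq j \leq m,\ i + j \leq m; \\ X_{2i-1} + X_{2j-1} + 1 \geq e_{i+j-1-m}, & \text{for } 1 \leq i \leq j \leq m,\ i + j \geq m+2; \\ \sum_{i=1}^{m} X_{2i-1} = g-\gamma. \end{cases} $$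
   Context: A numerical semigroup is a subset $S\subseteq\mathbb{N}_0$ with $0\in S$, closed under addition, and with finite complement $\mathbb{N}_0\setminus S$ (the set of gaps). The genus is the number of gaps and the multiplicity is the smallest nonzero element. $\langle a_1,\dots,a_r\rangle$ denotes the submonoid of $\mathbb{N}_0$ generated by $a_1,\dots,a_r$. For a numerical semigroup $S$, $S/2:=\{s\in\mathbb{N}_0 : 2s\in S\}$ (again a numerical semigroup, whose genus equals the number of even gaps of $S$). The paper denotes by $\mathcal S_\gamma(g)$ the set of numerical semigroups of genus $g$ with exactly $\gamma$ even gaps, by $\mathcal S_\gamma$ the set of numerical semigroups of genus $\gamma$, and by $\mathbf x_g:\mathcal S_\gamma(g)\to\mathcal S_\gamma$ the map $S\mapsto S/2$; the theorem characterizes the fiber $\mathbf x_g^{ -1}(T)$. -}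

module Defs where

open import Data.Nat using (ℕ; zero; suc; _+_; _*_; _∸_; _≤_; _<_)
open import Data.Bool using (Bool; true; false; if_then_else_)
open import Data.List using (List; []; _∷_; _++_; applyUpTo)
open import Data.Nat.ListAction using (sum)
open import Data.List.Membership.Propositional using (_∈_)
open import Data.Product using (Σ; _×_)
open import Data.Nat.DivMod using (_%_)
open import Relation.Binary.PropositionalEquality using (_≡_; _≢_)
open import Relation.Nullary using (¬_)

Subset : Set
Subset = ℕ → Bool

_∈S_ : ℕ → Subset → Set
n ∈S S = S n ≡ true

record IsNumericalSemigroup (S : Subset) : Set where
  field
    zero∈ : 0 ∈S S
    closed : ∀ a b → a ∈S S → b ∈S S → (a + b) ∈S S
    cofinite : Σ ℕ λ F → ∀ n → F ≤ n → n ∈S S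

gapsBelow : Subset → ℕ → ℕ
gapsBelow S zero = 0
gapsBelow S (suc n) = gapsBelow S n + (if S n then 0 else 1)

HasGenus : Subset → ℕ → Set
HasGenus S g = Σ ℕ λ F → (∀ n → F ≤ n → n ∈S S) × (gapsBelow S F ≡ g)

HasEvenGaps : Subset → ℕ → Set
HasEvenGaps S γ = Σ ℕ λ F → (∀ n → F ≤ n → n ∈S S) × (gapsBelow (λ i → S (2 * i)) F ≡ γ)

HasMultiplicity : Subset → ℕ → Set
HasMultiplicity S m = (m ≢ 0) × (m ∈S S) × (∀ t → t ∈S S → t ≢ 0 → m ≤ t)

half : Subset → Subset
half S s = S (2 * s)

_≐_ : Subset → Subset → Set
S ≐ T = ∀ n → S n ≡ T n

data Generated (L : List ℕ) : ℕ → Set where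
  gen-zero : Generated L 0
  gen-add  : ∀ {a n} → a ∈ L → Generated L n → Generated L (a + n)

IsGeneratedBy : Subset → List ℕ → Set
IsGeneratedBy S L = ∀ n → (n ∈S S → Generated L n) × (Generated L n → n ∈S S)

IsMinInClass : Subset → (m : ℕ) → .{{_ : Data.Nat.NonZero m}} → ℕ → ℕ → Set
IsMinInClass T m i x = (x ∈S T) × (x % m ≡ i % m) × (∀ t → t ∈S T → t % m ≡ i % m → x ≤ t)

-- generators 2m, 2m e_j + 2j (1 ≤ j ≤ m-1), 2m k_i + (2i-1) (1 ≤ i ≤ m)
-- e j stands for e_j, k i stands for k_{2i-1}
generatorsS : (m : ℕ) → (e k : ℕ → ℕ) → List ℕ
generatorsS m e k =
  (2 * m) ∷ (applyUpTo (λ j → 2 * m * e (suc j) + 2 * suc j) (m ∸ 1)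
         ++ applyUpTo (λ i → 2 * m * k (suc i) + suc (2 * i)) m)

-- the linear system; X i stands for X_{2i-1}, e j for e_j
-- the last equation  Σ X_{2i-1} = g - γ  is written  Σ X_{2i-1} + γ = g
record SolvesSystem (m : ℕ) (e : ℕ → ℕ) (g γ : ℕ) (X : ℕ → ℕ) : Set where
  field
    eq1 : ∀ i j → 1 ≤ i → i ≤ m → 1 ≤ j → j ≤ m ∸ 1 → i + j ≤ m →
          X (i + j) ≤ X i + e j
    eq2 : ∀ i j → 1 ≤ i → i ≤ m → 1 ≤ j → j ≤ m ∸ 1 → m < i + j →
          X (i + j ∸ m) ≤ X i + e j + 1
    eq3 : ∀ i j → 1 ≤ i → i ≤ j → j ≤ m → i + j ≤ m →
          e (i + j ∸ 1) ≤ X i + X j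
    eq4 : ∀ i j → 1 ≤ i → i ≤ j → j ≤ m → m + 2 ≤ i + j →
          e (i + j ∸ 1 ∸ m) ≤ X i + X j + 1
    eqSum : sum (applyUpTo (λ i → X (suc i)) m) + γ ≡ g

module Submission where

-- Let T have multiplicity m and Apéry elements m·e_r + r, so that for r < m
-- one has  m·d + r ∈ T  iff  d ≥ level r  (level 0 = 0, level r = e_r).
-- If S/2 = T, the even part of S is 2T, and in each odd class 2j+1 modulo 2m
-- adding 2m ∈ S moves one level up, so that class is the set of
-- 2mq + 2j+1 with q ≥ k_{j+1} for a threshold k_{j+1}.  Hence S equals
--   Ext k = 2T ∪ { 2mq + 2j+1 : j < m, q ≥ k_{j+1} }.

open import Defs
open import Data.Nat using (ℕ; _≤_; _<_; _+_; _*_; NonZero)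
open import Data.Product using (Σ; _×_)
open import Function.Bundles using (_⇔_)

open import Data.Nat using (zero; suc; _∸_; z≤n; s≤s; _≤′_; ≤′-step; ≤′-reflexive; >-nonZero)
open import Data.Nat.Properties
open import Data.Nat.DivMod using (_/_; _%_; m≡m%n+[m/n]*n; m%n<n; [m+kn]%n≡m%n; m<n⇒m%n≡m)
open import Data.Nat.ListAction using (sum)
open import Data.Nat.ListAction.Properties using (sum-++)
open import Data.Nat.Tactic.RingSolver using (solve-∀)
open import Data.Bool using (Bool; true; false; if_then_else_)
open import Data.Bool.Properties using (¬-not)
open import Data.List using (List; [_]; _++_; applyUpTo)
open import Data.List.Properties using (applyUpTo-∷ʳ)
open import Data.List.Relation.Unary.Any using (here; there)
open import Data.List.Membership.Propositional using (_∈_)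
open import Data.List.Membership.Propositional.Properties
  using (∈-++⁻; ∈-++⁺ˡ; ∈-++⁺ʳ; ∈-applyUpTo⁻; ∈-applyUpTo⁺)
open import Data.Product using (_,_; proj₁; proj₂)
open import Data.Sum using (_⊎_; inj₁; inj₂)
open import Data.Empty using (⊥-elim)
open import Relation.Nullary using (yes; no)
open import Function using (_∘_)
open import Function.Bundles using (mk⇔; Equivalence)
open import Function.Construct.Composition using (_⇔-∘_)
open import Function.Construct.Symmetry using (⇔-sym)
open import Relation.Binary.PropositionalEquality hiding ([_])
open ≡-Reasoning

open Equivalence using (to; from)

true-⇔ : ∀ {a b} → a ≡ true ⇔ b ≡ true → a ≡ b
true-⇔ {true}  {true}  _ = refl
true-⇔ {true}  {false} h = sym (to h refl)
true-⇔ {false} {true}  h = from h refl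
true-⇔ {false} {false} _ = refl

gap : Bool → ℕ
gap b = if b then 0 else 1

sum-applyUpTo-suc : ∀ h n → sum (applyUpTo h (suc n)) ≡ sum (applyUpTo h n) + h n
sum-applyUpTo-suc h n = begin
  sum (applyUpTo h (suc n))       ≡⟨ cong sum (sym (applyUpTo-∷ʳ h n)) ⟩
  sum (applyUpTo h n ++ [ h n ])  ≡⟨ sum-++ (applyUpTo h n) [ h n ] ⟩
  sum (applyUpTo h n) + (h n + 0) ≡⟨ cong (sum (applyUpTo h n) +_) (+-identityʳ (h n)) ⟩
  sum (applyUpTo h n) + h n       ∎

sum-applyUpTo-cong : ∀ {f h} n → (∀ j → j < n → f j ≡ h j) →
  sum (applyUpTo f n) ≡ sum (applyUpTo h n)
sum-applyUpTo-cong zero    _  = refl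
sum-applyUpTo-cong (suc n) eq =
  cong₂ _+_ (eq 0 (s≤s z≤n)) (sum-applyUpTo-cong n (λ j j<n → eq (suc j) (s≤s j<n)))

sum-applyUpTo-+ : ∀ f h n →
  sum (applyUpTo (λ j → f j + h j) n) ≡ sum (applyUpTo f n) + sum (applyUpTo h n)
sum-applyUpTo-+ f h zero    = refl
sum-applyUpTo-+ f h (suc n) = begin
  f 0 + h 0 + sum (applyUpTo (λ j → f (suc j) + h (suc j)) n)
    ≡⟨ cong (f 0 + h 0 +_) (sum-applyUpTo-+ (f ∘ suc) (h ∘ suc) n) ⟩
  f 0 + h 0 + (sum (applyUpTo (f ∘ suc) n) + sum (applyUpTo (h ∘ suc) n))
    ≡⟨ +-interchange (f 0) (h 0) _ _ ⟩
  f 0 + sum (applyUpTo (f ∘ suc) n) + (h 0 + sum (applyUpTo (h ∘ suc) n)) ∎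
  where
  +-interchange : ∀ a b c d → a + b + (c + d) ≡ a + c + (b + d)
  +-interchange = solve-∀

sum-applyUpTo-zero : ∀ n → sum (applyUpTo (λ _ → 0) n) ≡ 0
sum-applyUpTo-zero zero    = refl
sum-applyUpTo-zero (suc n) = sum-applyUpTo-zero n

gapsBelow-as-sum : ∀ f n → gapsBelow f n ≡ sum (applyUpTo (λ j → gap (f j)) n)
gapsBelow-as-sum f zero    = refl
gapsBelow-as-sum f (suc n) =
  trans (cong (_+ gap (f n)) (gapsBelow-as-sum f n)) (sym (sum-applyUpTo-suc _ n))

gapsBelow-cong : ∀ {f h} n → (∀ j → f j ≡ h j) → gapsBelow f n ≡ gapsBelow h n
gapsBelow-cong zero    eq = refl
gapsBelow-cong (suc n) eq = cong₂ _+_ (gapsBelow-cong n eq) (cong gap (eq n))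

gapsBelow-+ : ∀ f a b → gapsBelow f (a + b) ≡ gapsBelow f a + gapsBelow (λ i → f (a + i)) b
gapsBelow-+ f a zero    = trans (cong (gapsBelow f) (+-identityʳ a)) (sym (+-identityʳ _))
gapsBelow-+ f a (suc b) = begin
  gapsBelow f (a + suc b)                                         ≡⟨ cong (gapsBelow f) (+-suc a b) ⟩
  gapsBelow f (a + b) + gap (f (a + b))                           ≡⟨ cong (_+ gap (f (a + b))) (gapsBelow-+ f a b) ⟩
  gapsBelow f a + gapsBelow (λ i → f (a + i)) b + gap (f (a + b)) ≡⟨ +-assoc (gapsBelow f a) _ _ ⟩
  gapsBelow f a + gapsBelow (λ i → f (a + i)) (suc b)             ∎

gapsBelow-stable : ∀ f {F F'} → (∀ n → F ≤ n → f n ≡ true) → F ≤ F' →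
  gapsBelow f F' ≡ gapsBelow f F
gapsBelow-stable f {F' = zero}   _  z≤n = refl
gapsBelow-stable f {F} {suc F'} bd F≤ with m≤n⇒m<n∨m≡n F≤
... | inj₂ refl     = refl
... | inj₁ (s≤s F≤F') rewrite bd F' F≤F' = trans (+-identityʳ _) (gapsBelow-stable f bd F≤F')

gapsBelow-bounds : ∀ f {F F'} → (∀ n → F ≤ n → f n ≡ true) → (∀ n → F' ≤ n → f n ≡ true) →
  gapsBelow f F ≡ gapsBelow f F'
gapsBelow-bounds f {F} {F'} bd bd' =
  trans (sym (gapsBelow-stable f bd (m≤m+n F F'))) (gapsBelow-stable f bd' (m≤n+m F' F))

gapsBelow-all-gaps : ∀ f n → (∀ j → j < n → f j ≡ false) → gapsBelow f n ≡ n
gapsBelow-all-gaps f zero    _    = refl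
gapsBelow-all-gaps f (suc n) none rewrite none n ≤-refl =
  trans (cong (_+ 1) (gapsBelow-all-gaps f n (λ j j<n → none j (m≤n⇒m≤1+n j<n)))) (+-comm n 1)

gapsBelow-threshold : ∀ f k N → (∀ q → f q ≡ true ⇔ k ≤ q) → k ≤ N → gapsBelow f N ≡ k
gapsBelow-threshold f k N char k≤N =
  trans (gapsBelow-stable f (λ q → from (char q)) k≤N)
        (gapsBelow-all-gaps f k (λ j j<k → ¬-not (λ fj → <⇒≱ j<k (to (char j) fj))))

upward-threshold : ∀ f F → (∀ q → f q ≡ true → f (suc q) ≡ true) →
  (∀ q → F ≤ q → f q ≡ true) → ∀ q → f q ≡ true ⇔ gapsBelow f F ≤ q
upward-threshold f F up bd = go F (bd F ≤-refl)
  where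
  mono′ : ∀ {a b} → a ≤′ b → f a ≡ true → f b ≡ true
  mono′ (≤′-reflexive refl) fa = fa
  mono′ (≤′-step a≤b)       fa = up _ (mono′ a≤b fa)

  mono : ∀ {a b} → a ≤ b → f a ≡ true → f b ≡ true
  mono = mono′ ∘ ≤⇒≤′

  go : ∀ G → f G ≡ true → ∀ q → f q ≡ true ⇔ gapsBelow f G ≤ q
  go zero    fG q = mk⇔ (λ _ → z≤n) (λ _ → mono z≤n fG)
  go (suc G) fG q with f G in fG'
  ... | true  = subst (λ c → f q ≡ true ⇔ c ≤ q) (sym (+-identityʳ _)) (go G fG' q)
  ... | false = subst (λ c → f q ≡ true ⇔ c + 1 ≤ q) (sym below) (mk⇔ above reaches)
    where
    notG : ∀ {j} → j ≤ G → f j ≢ true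
    notG j≤G fj with trans (sym (mono j≤G fj)) fG'
    ... | ()
    below : gapsBelow f G ≡ G
    below = gapsBelow-all-gaps f G (λ j j<G → ¬-not (notG (<⇒≤ j<G)))
    above : f q ≡ true → G + 1 ≤ q
    above fq = subst (_≤ q) (+-comm 1 G) (≰⇒> (λ q≤G → notG q≤G fq))
    reaches : G + 1 ≤ q → f q ≡ true
    reaches le = mono (subst (_≤ q) (+-comm G 1) le) fG

gapsBelow-parity : ∀ f n →
  gapsBelow f (2 * n) ≡ gapsBelow (λ i → f (2 * i)) n + gapsBelow (λ i → f (suc (2 * i))) n
gapsBelow-parity f zero    = refl
gapsBelow-parity f (suc n) = begin
  gapsBelow f (2 * suc n)
    ≡⟨ cong (gapsBelow f) (two-suc n) ⟩
  gapsBelow f (2 * n) + gap (f (2 * n)) + gap (f (suc (2 * n)))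
    ≡⟨ cong (λ c → c + gap (f (2 * n)) + gap (f (suc (2 * n)))) (gapsBelow-parity f n) ⟩
  E + O + gap (f (2 * n)) + gap (f (suc (2 * n)))
    ≡⟨ regroup E O _ _ ⟩
  E + gap (f (2 * n)) + (O + gap (f (suc (2 * n)))) ∎
  where
  E = gapsBelow (λ i → f (2 * i)) n
  O = gapsBelow (λ i → f (suc (2 * i))) n
  two-suc : ∀ n → 2 * suc n ≡ suc (suc (2 * n))
  two-suc = solve-∀
  regroup : ∀ a b c d → a + b + c + d ≡ a + c + (b + d)
  regroup = solve-∀

gapsBelow-residues : ∀ f m N →
  gapsBelow f (m * N) ≡ sum (applyUpTo (λ j → gapsBelow (λ q → f (m * q + j)) N) m)
gapsBelow-residues f m zero = begin
  gapsBelow f (m * 0)                         ≡⟨ cong (gapsBelow f) (*-zeroʳ m) ⟩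
  0                                           ≡⟨ sym (sum-applyUpTo-zero m) ⟩
  sum (applyUpTo (λ j → gapsBelow (λ q → f (m * q + j)) zero) m) ∎
gapsBelow-residues f m (suc N) = begin
  gapsBelow f (m * suc N)
    ≡⟨ cong (gapsBelow f) (trans (*-suc m N) (+-comm m (m * N))) ⟩
  gapsBelow f (m * N + m)
    ≡⟨ gapsBelow-+ f (m * N) m ⟩
  gapsBelow f (m * N) + gapsBelow (λ j → f (m * N + j)) m
    ≡⟨ cong₂ _+_ (gapsBelow-residues f m N) (gapsBelow-as-sum (λ j → f (m * N + j)) m) ⟩
  sum (applyUpTo (λ j → gapsBelow (λ q → f (m * q + j)) N) m) + sum (applyUpTo (λ j → gap (f (m * N + j))) m)
    ≡⟨ sym (sum-applyUpTo-+ (λ j → gapsBelow (λ q → f (m * q + j)) N) (λ j → gap (f (m * N + j))) m) ⟩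
  sum (applyUpTo (λ j → gapsBelow (λ q → f (m * q + j)) (suc N)) m) ∎

half-gaps : ∀ {S T γ F} → half S ≐ T → HasGenus T γ → (∀ n → F ≤ n → S n ≡ true) →
  gapsBelow (half S) F ≡ γ
half-gaps {S} {T} {γ} {F} hS (FT , bdT , genus) bdS = begin
  gapsBelow (half S) F ≡⟨ gapsBelow-cong F hS ⟩
  gapsBelow T F        ≡⟨ gapsBelow-bounds T bd bdT ⟩
  gapsBelow T FT       ≡⟨ genus ⟩
  γ                    ∎
  where
  bd : ∀ n → F ≤ n → T n ≡ true
  bd n F≤n = trans (sym (hS n)) (bdS (2 * n) (≤-trans F≤n (m≤n*m n 2)))

odd-as-suc : ∀ m q j → 2 * m * q + suc (2 * j) ≡ suc (2 * (m * q + j))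
odd-as-suc = solve-∀

even+odd : ∀ m a r q i →
  2 * (m * a + r) + (2 * m * q + suc (2 * i)) ≡ 2 * m * (q + a) + suc (2 * (i + r))
even+odd = solve-∀

odd-wrap : ∀ m q c → 2 * m * q + suc (2 * (m + c)) ≡ 2 * m * (q + 1) + suc (2 * c)
odd-wrap = solve-∀

odd+odd : ∀ m q i q' j →
  2 * m * q + suc (2 * i) + (2 * m * q' + suc (2 * j)) ≡ 2 * (m * (q + q') + suc (i + j))
odd+odd = solve-∀

residue-wrap : ∀ m d c → m * d + (m + c) ≡ m * (d + 1) + c
residue-wrap = solve-∀

module Division (m : ℕ) .{{_ : NonZero m}} where

  division : ∀ t → t ≡ m * (t / m) + t % m
  division t = trans (m≡m%n+[m/n]*n t m) (trans (+-comm (t % m) _) (cong (_+ t % m) (*-comm (t / m) m)))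

  residue : ∀ d r → (m * d + r) % m ≡ r % m
  residue d r = trans (cong (_% m) (trans (+-comm (m * d) r) (cong (r +_) (*-comm m d)))) ([m+kn]%n≡m%n r d m)

  residue-of-small : ∀ d r → r < m → (m * d + r) % m ≡ r
  residue-of-small d r r<m = trans (residue d r) (m<n⇒m%n≡m r<m)

  division-unique : ∀ {q j q' j'} → j < m → j' < m → m * q + j ≡ m * q' + j' → q ≡ q' × j ≡ j'
  division-unique {q} {j} {q'} {j'} j<m j'<m eq = *-cancelˡ-≡ q q' m (+-cancelʳ-≡ j _ _ eq') , j≡j'
    where
    j≡j' : j ≡ j'
    j≡j' = trans (sym (residue-of-small q j j<m)) (trans (cong (_% m) eq) (residue-of-small q' j' j'<m))
    eq' : m * q + j ≡ m * q' + j
    eq' = trans eq (cong (m * q' +_) (sym j≡j'))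

  residue-split : ∀ s → s < m + m → s < m ⊎ Σ ℕ (λ c → c < m × s ≡ m + c)
  residue-split s s<2m with s <? m
  ... | yes s<m = inj₁ s<m
  ... | no  s≮m = inj₂ (s ∸ m , m<n+o⇒m∸n<o s m s<2m , sym (m+[n∸m]≡n (≮⇒≥ s≮m)))

  wrapped-small : ∀ {s c} → s < m + m → s ≡ m + c → c < m
  wrapped-small {c = c} s<2m refl = +-cancelˡ-< m c m s<2m

module Setting (m : ℕ) {{_ : NonZero m}} (T : Subset) (Tns : IsNumericalSemigroup T)
  (Tmult : HasMultiplicity T m) (e : ℕ → ℕ)
  (apery : ∀ i → 1 ≤ i → i < m → IsMinInClass T m i (m * e i + i)) where

  open IsNumericalSemigroup Tns renaming (zero∈ to 0∈T; closed to T-closed)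
  open Division m

  -- level r is the least level reached by T in the residue class r (level 0 = 0).
  level : ℕ → ℕ
  level zero    = 0
  level (suc r) = e (suc r)

  m∈T : T m ≡ true
  m∈T = proj₁ (proj₂ Tmult)

  multiple∈T : ∀ a → T (m * a) ≡ true
  multiple∈T zero    = subst (λ x → T x ≡ true) (sym (*-zeroʳ m)) 0∈T
  multiple∈T (suc a) = subst (λ x → T x ≡ true) (sym (*-suc m a)) (T-closed m (m * a) m∈T (multiple∈T a))

  T-criterion : ∀ d r → r < m → T (m * d + r) ≡ true ⇔ level r ≤ d
  T-criterion d zero _ =
    mk⇔ (λ _ → z≤n) (λ _ → subst (λ x → T x ≡ true) (sym (+-identityʳ (m * d))) (multiple∈T d))
  T-criterion d (suc r) r<m = mk⇔ minimal reached
    where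
    least = apery (suc r) (s≤s z≤n) r<m
    minimal : T (m * d + suc r) ≡ true → e (suc r) ≤ d
    minimal t = *-cancelˡ-≤ m (+-cancelʳ-≤ (suc r) _ _ (proj₂ (proj₂ least) (m * d + suc r) t (residue d (suc r))))
    reached : e (suc r) ≤ d → T (m * d + suc r) ≡ true
    reached le = subst (λ x → T x ≡ true) eq (T-closed _ _ (multiple∈T (d ∸ e (suc r))) (proj₁ least))
      where
      eq : m * (d ∸ e (suc r)) + (m * e (suc r) + suc r) ≡ m * d + suc r
      eq = begin
        m * (d ∸ e (suc r)) + (m * e (suc r) + suc r) ≡⟨ sym (+-assoc (m * (d ∸ e (suc r))) _ (suc r)) ⟩
        m * (d ∸ e (suc r)) + m * e (suc r) + suc r   ≡⟨ cong (_+ suc r) (sym (*-distribˡ-+ m _ (e (suc r)))) ⟩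
        m * (d ∸ e (suc r) + e (suc r)) + suc r       ≡⟨ cong (λ x → m * x + suc r) (m∸n+n≡m le) ⟩
        m * d + suc r                                 ∎

  T-level : ∀ t → T t ≡ true → level (t % m) ≤ t / m
  T-level t t∈T = to (T-criterion (t / m) (t % m) (m%n<n t m)) (subst (λ x → T x ≡ true) (division t) t∈T)

  oddAt : ℕ → ℕ → ℕ
  oddAt q j = 2 * m * q + suc (2 * j)

  data Ext (k : ℕ → ℕ) : ℕ → Set where
    ext-even : ∀ t → T t ≡ true → Ext k (2 * t)
    ext-odd  : ∀ q j → j < m → k (suc j) ≤ q → Ext k (oddAt q j)

  even≢oddAt : ∀ t q j → 2 * t ≢ oddAt q j
  even≢oddAt t q j eq = even≢odd t (m * q + j) (trans eq (odd-as-suc m q j))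

  oddAt-injective : ∀ {q j q' j'} → j < m → j' < m → oddAt q j ≡ oddAt q' j' → q ≡ q' × j ≡ j'
  oddAt-injective {q} {j} {q'} {j'} j<m j'<m eq = division-unique j<m j'<m
    (*-cancelˡ-≡ _ _ 2 (suc-injective (trans (sym (odd-as-suc m q j)) (trans eq (odd-as-suc m q' j')))))

  ext-even⁻¹ : ∀ {k} t → Ext k (2 * t) → T t ≡ true
  ext-even⁻¹ {k} t = go refl
    where
    go : ∀ {n} → n ≡ 2 * t → Ext k n → T t ≡ true
    go eq (ext-even t' t'∈T) rewrite *-cancelˡ-≡ t' t 2 eq = t'∈T
    go eq (ext-odd q j _ _)  = ⊥-elim (even≢oddAt t q j (sym eq))

  ext-odd⁻¹ : ∀ {k} q j → j < m → Ext k (oddAt q j) → k (suc j) ≤ q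
  ext-odd⁻¹ {k} q j j<m = go refl
    where
    go : ∀ {n} → n ≡ oddAt q j → Ext k n → k (suc j) ≤ q
    go eq (ext-even t _) = ⊥-elim (even≢oddAt t q j eq)
    go eq (ext-odd q' j' j'<m le) with oddAt-injective j'<m j<m eq
    ... | refl , refl = le

  even-or-odd : ∀ n → Σ ℕ (λ t → n ≡ 2 * t) ⊎ Σ ℕ (λ q → Σ ℕ (λ j → j < m × n ≡ oddAt q j))
  even-or-odd zero = inj₁ (0 , refl)
  even-or-odd (suc n) with even-or-odd n
  ... | inj₂ (q , j , _ , refl) = inj₁ (m * q + j + 1 , next-even m q j)
    where
    next-even : ∀ m q j → suc (2 * m * q + suc (2 * j)) ≡ 2 * (m * q + j + 1)
    next-even = solve-∀
  ... | inj₁ (t , refl) = inj₂ (t / m , t % m , m%n<n t m ,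
        trans (cong (λ x → suc (2 * x)) (division t)) (sym (odd-as-suc m (t / m) (t % m))))

  record Represents (S : Subset) (k : ℕ → ℕ) : Set where
    field
      halves : half S ≐ T
      odds   : ∀ q j → j < m → S (oddAt q j) ≡ true ⇔ k (suc j) ≤ q

  represents⇒ext : ∀ {S k} → Represents S k → ∀ n → S n ≡ true ⇔ Ext k n
  represents⇒ext {S} {k} R n = mk⇔ into out
    where
    open Represents R
    into : ∀ {n} → S n ≡ true → Ext k n
    into {n} n∈S with even-or-odd n
    ... | inj₁ (t , refl)          = ext-even t (trans (sym (halves t)) n∈S)
    ... | inj₂ (q , j , j<m , refl) = ext-odd q j j<m (to (odds q j j<m) n∈S)
    out : ∀ {n} → Ext k n → S n ≡ true
    out (ext-even t t∈T)     = trans (halves t) t∈T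
    out (ext-odd q j j<m le) = from (odds q j j<m) le

  ext⇒represents : ∀ {S k} → (∀ n → S n ≡ true ⇔ Ext k n) → Represents S k
  ext⇒represents {S} {k} S≡Ext = record
    { halves = λ t → true-⇔ (mk⇔ (ext-even⁻¹ t ∘ to (S≡Ext (2 * t))) (from (S≡Ext (2 * t)) ∘ ext-even t))
    ; odds   = λ q j j<m → mk⇔ (ext-odd⁻¹ q j j<m ∘ to (S≡Ext (oddAt q j)))
                                (from (S≡Ext (oddAt q j)) ∘ ext-odd q j j<m)
    }

  level≤oddAt : ∀ q j → q ≤ oddAt q j
  level≤oddAt q j = ≤-trans (m≤n*m q (2 * m)) (m≤m+n (2 * m * q) _)
    where
    instance
      2m≢0 : NonZero (2 * m)
      2m≢0 = m*n≢0 2 m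

  -- The conditions of Theorem 3.3 in normalised form: odd classes are indexed
  -- from 0 (class i stands for 2i+1, threshold k_{i+1}), the Apéry exponent
  -- e_j is read as level j, and a wrap-around of an index is written as m + c.
  -- shift/shiftWrap say that adding an element of 2T to an odd element stays
  -- in Ext k; pair/pairWrap say that the sum of two odd elements lies in 2T.
  record Inequalities (k : ℕ → ℕ) : Set where
    field
      shift     : ∀ i j → i < m → j < m → i + j < m → k (suc (i + j)) ≤ k (suc i) + level j
      shiftWrap : ∀ i j c → i < m → j < m → i + j ≡ m + c → k (suc c) ≤ k (suc i) + level j + 1
      pair      : ∀ i j → i < m → j < m → suc (i + j) < m →
                  level (suc (i + j)) ≤ k (suc i) + k (suc j)
      pairWrap  : ∀ i j c → i < m → j < m → suc (i + j) ≡ m + c →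
                  level c ≤ k (suc i) + k (suc j) + 1

  -- The cases
  -- j = 0 of shift/shiftWrap and c = 0 of pairWrap are trivial, and pair and
  -- pairWrap follow from their ordered instances i ≤ j by symmetry.
  system⇒inequalities : ∀ {g γ k} → SolvesSystem m e g γ k → Inequalities k
  system⇒inequalities {k = k} sys = record
    { shift = shift ; shiftWrap = shiftWrap ; pair = pair ; pairWrap = pairWrap }
    where
    open SolvesSystem sys

    shift : ∀ i j → i < m → j < m → i + j < m → k (suc (i + j)) ≤ k (suc i) + level j
    shift i zero    _   _   _ = ≤-reflexive (trans (cong (k ∘ suc) (+-identityʳ i)) (sym (+-identityʳ _)))
    shift i (suc j) i<m j<m s = eq1 (suc i) (suc j) (s≤s z≤n) i<m (s≤s z≤n) (<⇒≤pred j<m) s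

    shiftWrap : ∀ i j c → i < m → j < m → i + j ≡ m + c → k (suc c) ≤ k (suc i) + level j + 1
    shiftWrap i zero c i<m _ E =
      ⊥-elim (<⇒≱ i<m (subst (m ≤_) (trans (sym E) (+-identityʳ i)) (m≤m+n m c)))
    shiftWrap i (suc j) c i<m j<m E =
      subst (λ x → k x ≤ k (suc i) + e (suc j) + 1) index
        (eq2 (suc i) (suc j) (s≤s z≤n) i<m (s≤s z≤n) (<⇒≤pred j<m) wraps)
      where
      wraps : m < suc i + suc j
      wraps = s≤s (subst (m ≤_) (sym E) (m≤m+n m c))
      index : suc i + suc j ∸ m ≡ suc c
      index = trans (cong (λ x → suc x ∸ m) E) (trans (cong (_∸ m) (sym (+-suc m c))) (m+n∸m≡n m (suc c)))

    pair-ordered : ∀ i j → i ≤ j → j < m → suc (i + j) < m →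
      level (suc (i + j)) ≤ k (suc i) + k (suc j)
    pair-ordered i j i≤j j<m s = subst (λ x → e x ≤ k (suc i) + k (suc j)) (+-suc i j)
      (eq3 (suc i) (suc j) (s≤s z≤n) (s≤s i≤j) j<m (subst (_≤ m) (cong suc (sym (+-suc i j))) s))

    pair : ∀ i j → i < m → j < m → suc (i + j) < m → level (suc (i + j)) ≤ k (suc i) + k (suc j)
    pair i j i<m j<m s with ≤-total i j
    ... | inj₁ i≤j = pair-ordered i j i≤j j<m s
    ... | inj₂ j≤i = subst₂ (λ x y → level (suc x) ≤ y) (+-comm j i) (+-comm (k (suc j)) (k (suc i)))
                       (pair-ordered j i j≤i i<m (subst (λ x → suc x < m) (+-comm i j) s))

    pairWrap-ordered : ∀ i j c → i ≤ j → j < m → suc (i + j) ≡ m + c →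
      level c ≤ k (suc i) + k (suc j) + 1
    pairWrap-ordered i j zero    _   _   _ = z≤n
    pairWrap-ordered i j (suc c) i≤j j<m E =
      subst (λ x → e x ≤ k (suc i) + k (suc j) + 1) index (eq4 (suc i) (suc j) (s≤s z≤n) (s≤s i≤j) j<m bound)
      where
      sum≡ : i + suc j ≡ m + suc c
      sum≡ = trans (+-suc i j) E
      index : i + suc j ∸ m ≡ suc c
      index = trans (cong (_∸ m) sum≡) (m+n∸m≡n m (suc c))
      bound : m + 2 ≤ suc i + suc j
      bound = subst (m + 2 ≤_) (trans (+-suc m (suc c)) (cong suc (sym sum≡))) (+-monoʳ-≤ m (s≤s (s≤s z≤n)))

    pairWrap : ∀ i j c → i < m → j < m → suc (i + j) ≡ m + c → level c ≤ k (suc i) + k (suc j) + 1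
    pairWrap i j c i<m j<m E with ≤-total i j
    ... | inj₁ i≤j = pairWrap-ordered i j c i≤j j<m E
    ... | inj₂ j≤i = subst (λ y → level c ≤ y + 1) (+-comm (k (suc j)) (k (suc i)))
                       (pairWrap-ordered j i c j≤i i<m (trans (cong suc (+-comm j i)) E))

  inequalities⇒system : ∀ {g γ k} → Inequalities k → sum (applyUpTo (λ i → k (suc i)) m) + γ ≡ g →
    SolvesSystem m e g γ k
  inequalities⇒system {k = k} ineq total = record
    { eq1 = eq1 ; eq2 = eq2 ; eq3 = eq3 ; eq4 = eq4 ; eqSum = total }
    where
    open Inequalities ineq

    eq1 : ∀ i j → 1 ≤ i → i ≤ m → 1 ≤ j → j ≤ m ∸ 1 → i + j ≤ m → k (i + j) ≤ k i + e j
    eq1 zero    _       ()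
    eq1 (suc i) zero    _ _   ()
    eq1 (suc i) (suc j) _ i<m _ j≤ s = shift i (suc j) i<m (m≤pred[n]⇒suc[m]≤n j≤) s

    eq2 : ∀ i j → 1 ≤ i → i ≤ m → 1 ≤ j → j ≤ m ∸ 1 → m < i + j → k (i + j ∸ m) ≤ k i + e j + 1
    eq2 zero    _       ()
    eq2 (suc i) zero    _ _   ()
    eq2 (suc i) (suc j) _ i<m _ j≤ s =
      subst (λ x → k x ≤ k (suc i) + e (suc j) + 1) (sym (+-∸-assoc 1 m≤))
        (shiftWrap i (suc j) c i<m (m≤pred[n]⇒suc[m]≤n j≤) sum≡)
      where
      m≤ : m ≤ i + suc j
      m≤ = ≤-pred s
      c = i + suc j ∸ m
      sum≡ : i + suc j ≡ m + c
      sum≡ = sym (m+[n∸m]≡n m≤)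

    eq3 : ∀ i j → 1 ≤ i → i ≤ j → j ≤ m → i + j ≤ m → e (i + j ∸ 1) ≤ k i + k j
    eq3 zero    _       ()
    eq3 (suc i) zero    _ ()
    eq3 (suc i) (suc j) _ i≤j j<m s = subst (λ x → e x ≤ k (suc i) + k (suc j)) (sym (+-suc i j))
      (pair i j (≤-trans i≤j j<m) j<m (subst (λ x → suc x ≤ m) (+-suc i j) s))

    eq4 : ∀ i j → 1 ≤ i → i ≤ j → j ≤ m → m + 2 ≤ i + j → e (i + j ∸ 1 ∸ m) ≤ k i + k j + 1
    eq4 zero    _       ()
    eq4 (suc i) zero    _ ()
    eq4 (suc i) (suc j) _ i≤j j<m s =
      subst (λ x → e x ≤ k (suc i) + k (suc j) + 1) (sym index) (pairWrap i j (suc c) (≤-trans i≤j j<m) j<m sum≡)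
      where
      m≤ : m ≤ i + j
      m≤ = ≤-pred (≤-pred (subst₂ _≤_ (+-comm m 2) (cong suc (+-suc i j)) s))
      c = i + j ∸ m
      sum≡ : suc (i + j) ≡ m + suc c
      sum≡ = trans (cong suc (sym (m+[n∸m]≡n m≤))) (sym (+-suc m c))
      index : i + suc j ∸ m ≡ suc c
      index = trans (cong (_∸ m) (+-suc i j)) (+-∸-assoc 1 m≤)

  module Closure {k : ℕ → ℕ} (ineq : Inequalities k) where
    open Inequalities ineq

    -- Adding an element 2t of 2T to an odd element of Ext k: writing
    -- t = m·a + r, the class moves by r (maybe wrapping) and the level by a.
    even+odd∈Ext : ∀ t q i → T t ≡ true → i < m → k (suc i) ≤ q → Ext k (2 * t + oddAt q i)
    even+odd∈Ext t q i t∈T i<m i≤q =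
      subst (λ x → Ext k (2 * x + oddAt q i)) (sym (division t))
        (subst (Ext k) (sym (even+odd m a r q i)) shifted)
      where
      a = t / m
      r = t % m
      r<m : r < m
      r<m = m%n<n t m
      levels : k (suc i) + level r ≤ q + a
      levels = +-mono-≤ i≤q (T-level t t∈T)
      shifted : Ext k (oddAt (q + a) (i + r))
      shifted with residue-split (i + r) (+-mono-< i<m r<m)
      ... | inj₁ s<m = ext-odd (q + a) (i + r) s<m (≤-trans (shift i r i<m r<m s<m) levels)
      ... | inj₂ (c , c<m , E) =
        subst (Ext k) (sym (trans (cong (oddAt (q + a)) E) (odd-wrap m (q + a) c)))
          (ext-odd (q + a + 1) c c<m (≤-trans (shiftWrap i r c i<m r<m E) (+-monoˡ-≤ 1 levels)))

    odd+odd∈Ext : ∀ q i q' j → i < m → j < m → k (suc i) ≤ q → k (suc j) ≤ q' →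
      Ext k (oddAt q i + oddAt q' j)
    odd+odd∈Ext q i q' j i<m j<m i≤q j≤q' =
      subst (Ext k) (sym (odd+odd m q i q' j)) (ext-even _ half∈T)
      where
      levels : k (suc i) + k (suc j) ≤ q + q'
      levels = +-mono-≤ i≤q j≤q'
      half∈T : T (m * (q + q') + suc (i + j)) ≡ true
      half∈T with residue-split (suc (i + j)) (subst (λ x → suc x ≤ m + m) (+-suc i j) (+-mono-≤ i<m j<m))
      ... | inj₁ s<m = from (T-criterion (q + q') (suc (i + j)) s<m) (≤-trans (pair i j i<m j<m s<m) levels)
      ... | inj₂ (c , c<m , E) =
        subst (λ x → T x ≡ true) (sym (trans (cong (m * (q + q') +_) E) (residue-wrap m (q + q') c)))
          (from (T-criterion (q + q' + 1) c c<m) (≤-trans (pairWrap i j c i<m j<m E) (+-monoˡ-≤ 1 levels)))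

    ext-closed : ∀ {a b} → Ext k a → Ext k b → Ext k (a + b)
    ext-closed (ext-even t t∈T) (ext-even t' t'∈T) =
      subst (Ext k) (*-distribˡ-+ 2 t t') (ext-even (t + t') (T-closed t t' t∈T t'∈T))
    ext-closed (ext-even t t∈T) (ext-odd q i i<m i≤q) = even+odd∈Ext t q i t∈T i<m i≤q
    ext-closed (ext-odd q i i<m i≤q) (ext-even t t∈T) =
      subst (Ext k) (+-comm (2 * t) (oddAt q i)) (even+odd∈Ext t q i t∈T i<m i≤q)
    ext-closed (ext-odd q i i<m i≤q) (ext-odd q' j j<m j≤q') = odd+odd∈Ext q i q' j i<m j<m i≤q j≤q'

  module Generation (k : ℕ → ℕ) where

    L : List ℕ
    L = generatorsS m e k

    evenGenerator : ℕ → ℕ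
    evenGenerator j = 2 * m * e (suc j) + 2 * suc j

    generator : ∀ {a} → a ∈ L → Generated L a
    generator {a} a∈L = subst (Generated L) (+-identityʳ a) (gen-add a∈L gen-zero)

    copies-of-2m : ∀ a {n} → Generated L n → Generated L (2 * m * a + n)
    copies-of-2m zero    {n} g = subst (Generated L) (sym (cong (_+ n) (*-zeroʳ (2 * m)))) g
    copies-of-2m (suc a) {n} g = subst (Generated L) (sym eq) (gen-add (here refl) (copies-of-2m a g))
      where
      eq : 2 * m * suc a + n ≡ 2 * m + (2 * m * a + n)
      eq = trans (cong (_+ n) (*-suc (2 * m) a)) (+-assoc (2 * m) _ n)

    -- 2(m·a + r) with level r ≤ a is a copies of 2m plus the even generator of class r.
    even-generated : ∀ a r → r < m → level r ≤ a → Generated L (2 * (m * a + r))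
    even-generated a zero    _   _  = subst (Generated L) (double m a) (copies-of-2m a gen-zero)
      where
      double : ∀ m a → 2 * m * a + 0 ≡ 2 * (m * a + 0)
      double = solve-∀
    even-generated a (suc r) r<m le = subst (Generated L) eq (copies-of-2m (a ∸ e (suc r)) (generator member))
      where
      member : evenGenerator r ∈ L
      member = there (∈-++⁺ˡ (∈-applyUpTo⁺ evenGenerator (<⇒≤pred r<m)))
      regroup : ∀ m d x r → 2 * m * d + (2 * m * x + 2 * r) ≡ 2 * (m * (d + x) + r)
      regroup = solve-∀
      eq : 2 * m * (a ∸ e (suc r)) + evenGenerator r ≡ 2 * (m * a + suc r)
      eq = trans (regroup m _ (e (suc r)) (suc r)) (cong (λ x → 2 * (m * x + suc r)) (m∸n+n≡m le))

    -- oddAt q j with q ≥ k_{j+1} is copies of 2m plus the odd generator of class j.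
    odd-generated : ∀ q j → j < m → k (suc j) ≤ q → Generated L (oddAt q j)
    odd-generated q j j<m le = subst (Generated L) eq (copies-of-2m (q ∸ k (suc j)) (generator member))
      where
      member : oddAt (k (suc j)) j ∈ L
      member = there (∈-++⁺ʳ (applyUpTo evenGenerator (m ∸ 1)) (∈-applyUpTo⁺ (λ i → oddAt (k (suc i)) i) j<m))
      regroup : ∀ m d x j → 2 * m * d + (2 * m * x + suc (2 * j)) ≡ 2 * m * (d + x) + suc (2 * j)
      regroup = solve-∀
      eq : 2 * m * (q ∸ k (suc j)) + oddAt (k (suc j)) j ≡ oddAt q j
      eq = trans (regroup m _ (k (suc j)) j) (cong (λ x → oddAt x j) (m∸n+n≡m le))

    ext⇒generated : ∀ {n} → Ext k n → Generated L n
    ext⇒generated (ext-even t t∈T) =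
      subst (λ x → Generated L (2 * x)) (sym (division t)) (even-generated (t / m) (t % m) (m%n<n t m) (T-level t t∈T))
    ext⇒generated (ext-odd q j j<m le) = odd-generated q j j<m le

    generator∈Ext : ∀ {a} → a ∈ L → Ext k a
    generator∈Ext (here refl) = ext-even m m∈T
    generator∈Ext (there a∈L) with ∈-++⁻ (applyUpTo evenGenerator (m ∸ 1)) a∈L
    ... | inj₁ a∈even with ∈-applyUpTo⁻ evenGenerator a∈even
    ...   | j , j<m , refl = subst (Ext k) (spread m (e (suc j)) (suc j))
            (ext-even _ (proj₁ (apery (suc j) (s≤s z≤n) (m≤pred[n]⇒suc[m]≤n j<m))))
      where
      spread : ∀ m x r → 2 * (m * x + r) ≡ 2 * m * x + 2 * r
      spread = solve-∀
    generator∈Ext (there a∈L) | inj₂ a∈odd with ∈-applyUpTo⁻ (λ i → oddAt (k (suc i)) i) a∈odd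
    ...   | i , i<m , refl = ext-odd (k (suc i)) i i<m ≤-refl

    generated⇔ext : Inequalities k → ∀ n → Generated L n ⇔ Ext k n
    generated⇔ext ineq n = mk⇔ generated⇒ext ext⇒generated
      where
      open Closure ineq
      generated⇒ext : ∀ {n} → Generated L n → Ext k n
      generated⇒ext gen-zero         = ext-even 0 0∈T
      generated⇒ext (gen-add a∈L g) = ext-closed (generator∈Ext a∈L) (generated⇒ext g)

  -- The thresholds of a semigroup S with S/2 = T satisfy the inequalities:
  -- S contains an odd element plus an element of 2T, and the sum of two odd
  -- elements, whose half then lies in T.
  represents⇒inequalities : ∀ {S k} → IsNumericalSemigroup S → Represents S k → Inequalities k
  represents⇒inequalities {S} {k} Sns R = record
    { shift = shift ; shiftWrap = shiftWrap ; pair = pair ; pairWrap = pairWrap }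
    where
    open Represents R
    open IsNumericalSemigroup Sns using () renaming (closed to S-closed)

    least-odd∈S : ∀ i → i < m → S (oddAt (k (suc i)) i) ≡ true
    least-odd∈S i i<m = from (odds _ i i<m) ≤-refl

    shifted∈S : ∀ i j → i < m → j < m → S (oddAt (k (suc i) + level j) (i + j)) ≡ true
    shifted∈S i j i<m j<m = subst (λ x → S x ≡ true)
      (trans (+-comm (oddAt (k (suc i)) i) _) (even+odd m (level j) j (k (suc i)) i))
      (S-closed _ _ (least-odd∈S i i<m) (trans (halves _) (from (T-criterion (level j) j j<m) ≤-refl)))

    half-sum∈T : ∀ i j → i < m → j < m → T (m * (k (suc i) + k (suc j)) + suc (i + j)) ≡ true
    half-sum∈T i j i<m j<m = trans (sym (halves _))
      (subst (λ x → S x ≡ true) (odd+odd m _ i _ j) (S-closed _ _ (least-odd∈S i i<m) (least-odd∈S j j<m)))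

    shift : ∀ i j → i < m → j < m → i + j < m → k (suc (i + j)) ≤ k (suc i) + level j
    shift i j i<m j<m s = to (odds _ (i + j) s) (shifted∈S i j i<m j<m)

    shiftWrap : ∀ i j c → i < m → j < m → i + j ≡ m + c → k (suc c) ≤ k (suc i) + level j + 1
    shiftWrap i j c i<m j<m E = to (odds _ c (wrapped-small (+-mono-< i<m j<m) E))
      (subst (λ x → S x ≡ true) (trans (cong (oddAt _) E) (odd-wrap m _ c)) (shifted∈S i j i<m j<m))

    pair : ∀ i j → i < m → j < m → suc (i + j) < m → level (suc (i + j)) ≤ k (suc i) + k (suc j)
    pair i j i<m j<m s = to (T-criterion _ (suc (i + j)) s) (half-sum∈T i j i<m j<m)

    pairWrap : ∀ i j c → i < m → j < m → suc (i + j) ≡ m + c → level c ≤ k (suc i) + k (suc j) + 1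
    pairWrap i j c i<m j<m E =
      to (T-criterion _ c (wrapped-small (subst (λ x → suc x ≤ m + m) (+-suc i j) (+-mono-≤ i<m j<m)) E))
        (subst (λ x → T x ≡ true) (trans (cong (m * d +_) E) (residue-wrap m d c)) (half-sum∈T i j i<m j<m))
      where
      d = k (suc i) + k (suc j)

  thresholds : Subset → ℕ → ℕ → ℕ
  thresholds S F zero    = 0
  thresholds S F (suc j) = gapsBelow (λ q → S (oddAt q j)) F

  -- A semigroup S with S/2 = T is represented by its thresholds: adding 2m
  -- moves up one level in an odd class, so each class is upward closed.
  thresholds-represent : ∀ {S F} → IsNumericalSemigroup S → (∀ n → F ≤ n → S n ≡ true) →
    half S ≐ T → Represents S (thresholds S F)
  thresholds-represent {S} {F} Sns bd hS = record
    { halves = hS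
    ; odds   = λ q j _ → upward-threshold (λ q → S (oddAt q j)) F (up j)
                           (λ q F≤q → bd _ (≤-trans F≤q (level≤oddAt q j))) q
    }
    where
    next-level : ∀ m q j → 2 * m + (2 * m * q + suc (2 * j)) ≡ 2 * m * suc q + suc (2 * j)
    next-level = solve-∀
    up : ∀ j q → S (oddAt q j) ≡ true → S (oddAt (suc q) j) ≡ true
    up j q q∈S = subst (λ x → S x ≡ true) (next-level m q j)
      (IsNumericalSemigroup.closed Sns (2 * m) _ (trans (hS m) m∈T) q∈S)

  -- The gaps of a represented S: the γ gaps of T, doubled, and k_{j+1} gaps
  -- in each odd class j.
  represented-genus : ∀ {S k γ F} → Represents S k → HasGenus T γ → (∀ n → F ≤ n → S n ≡ true) →
    gapsBelow S F ≡ sum (applyUpTo (λ i → k (suc i)) m) + γ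
  represented-genus {S} {k} {γ} {F} R Tg bd = begin
    gapsBelow S F                                      ≡⟨ sym (gapsBelow-stable S bd F≤2mF) ⟩
    gapsBelow S (2 * (m * F))                          ≡⟨ gapsBelow-parity S (m * F) ⟩
    gapsBelow (half S) (m * F) + gapsBelow odd (m * F) ≡⟨ cong₂ _+_ (half-gaps halves Tg bd-mF) odd-gaps ⟩
    γ + sum (applyUpTo (λ i → k (suc i)) m)            ≡⟨ +-comm γ _ ⟩
    sum (applyUpTo (λ i → k (suc i)) m) + γ            ∎
    where
    open Represents R
    odd : Subset
    odd i = S (suc (2 * i))
    F≤mF : F ≤ m * F
    F≤mF = m≤n*m F m
    F≤2mF : F ≤ 2 * (m * F)
    F≤2mF = ≤-trans F≤mF (m≤n*m (m * F) 2)
    bd-mF : ∀ n → m * F ≤ n → S n ≡ true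
    bd-mF n le = bd n (≤-trans F≤mF le)
    class-gaps : ∀ j → j < m → gapsBelow (λ q → odd (m * q + j)) F ≡ k (suc j)
    class-gaps j j<m = trans (gapsBelow-cong F (λ q → cong S (sym (odd-as-suc m q j))))
      (gapsBelow-threshold _ (k (suc j)) F (λ q → odds q j j<m)
        (to (odds F j j<m) (bd _ (level≤oddAt F j))))
    odd-gaps : gapsBelow odd (m * F) ≡ sum (applyUpTo (λ i → k (suc i)) m)
    odd-gaps = trans (gapsBelow-residues odd m F) (sum-applyUpTo-cong m class-gaps)

  semigroup⇒system : ∀ {S g γ} → IsNumericalSemigroup S → HasGenus T γ → HasGenus S g → half S ≐ T →
    Σ (ℕ → ℕ) (λ k → SolvesSystem m e g γ k × IsGeneratedBy S (generatorsS m e k))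
  semigroup⇒system {S} Sns Tg (F , bd , genus) hS =
    k , inequalities⇒system ineq (trans (sym (represented-genus R Tg bd)) genus) , generated
    where
    k = thresholds S F
    R = thresholds-represent Sns bd hS
    ineq = represents⇒inequalities Sns R
    generated : IsGeneratedBy S (generatorsS m e k)
    generated n = to S⇔⟨L⟩ , from S⇔⟨L⟩
      where S⇔⟨L⟩ = ⇔-sym (Generation.generated⇔ext k ineq n) ⇔-∘ represents⇒ext R n

  system⇒semigroup : ∀ {S g γ} → IsNumericalSemigroup S → HasGenus T γ →
    Σ (ℕ → ℕ) (λ k → SolvesSystem m e g γ k × IsGeneratedBy S (generatorsS m e k)) →
    HasGenus S g × HasEvenGaps S γ × (half S ≐ T)
  system⇒semigroup {S} Sns Tg (k , sys , generated) =
    (F , bd , trans (represented-genus R Tg bd) (SolvesSystem.eqSum sys)) ,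
    (F , bd , half-gaps (Represents.halves R) Tg bd) ,
    Represents.halves R
    where
    F  = proj₁ (IsNumericalSemigroup.cofinite Sns)
    bd = proj₂ (IsNumericalSemigroup.cofinite Sns)
    S⇔Ext : ∀ n → S n ≡ true ⇔ Ext k n
    S⇔Ext n = Generation.generated⇔ext k (system⇒inequalities sys) n
                ⇔-∘ mk⇔ (proj₁ (generated n)) (proj₂ (generated n))
    R = ext⇒represents S⇔Ext

theorem3p3 : (m γ g : ℕ) → .{{_ : NonZero m}} → 2 ≤ m → 1 ≤ γ →
    (T : Subset) → IsNumericalSemigroup T → HasGenus T γ → HasMultiplicity T m →
    (e : ℕ → ℕ) → (∀ i → 1 ≤ i → i < m → IsMinInClass T m i (m * e i + i)) →
    (S : Subset) → IsNumericalSemigroup S →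
    ((HasGenus S g × HasEvenGaps S γ × (half S ≐ T))
      ⇔ Σ (ℕ → ℕ) (λ k → SolvesSystem m e g γ k × IsGeneratedBy S (generatorsS m e k)))
theorem3p3 m γ g 2≤m _ T Tns Tg Tmult e apery S Sns =
  mk⇔ (λ { (Sg , _ , hS) → semigroup⇒system Sns Tg Sg hS }) (system⇒semigroup Sns Tg)
  where
  -- the instance argument is irrelevant, so NonZero m is rebuilt from 2 ≤ m
  open Setting m {{>-nonZero (≤-trans (s≤s z≤n) 2≤m)}} T Tns Tmult e apery
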